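{- Let $(N_1,m_1)\vartriangleright_E(N_2,m_2)$ with both marked nets safe, let $G$ be a well-formed TFG for this equivalence, and let $\mathcal{C}$ be the concurrency relation of $G$. For every node $v$ of $G$: if $v\,\mathcal{C}\,v$, then there is a root $v_0$ of $G$ such that $v_0\,\mathcal{C}\,v_0$ and $v_0\to^\star v$.
   Context: A Petri net $N=(P,T,\mathrm{Pre},\mathrm{Post})$ has a finite set of places $P$, a finite set of transitions $T$, and flow functions $\mathrm{Pre},\mathrm{Post}:T\to(P\to\mathbb{N})$. A marking is $m:P\to\mathbb{N}$; $t$ is enabled at $m$ if $m\ge\mathrm{Pre}(t)$, and firing gives $m-\mathrm{Pre}(t)+\mathrm{Post}(t)$. $R(N,m_0)$ is the set of markings reachable from $m_0$ by finite (possibly empty) firing sequences. $(N,m_0)$ is safe if every reachable marking has at most one token in each place. Linear systems: $E$ is a finite collection of equations $x=y_1+\dots+y_l$, with variable set $\mathrm{fv}(E)$; solutions are non-negative integer; consistent means having a solution. For a partial map $c$ defined exactly on $v_1,\dots,v_k$, $[c]$ is the system $v_1=c(v_1),\dots,v_k=c(v_k)$; commas denote union. $E$-equivalence: $(N_1,m_1)\vartriangleright_E(N_2,m_2)$ (place sets $P_1,P_2$) iff (A1) $E,[m]$ consistent for every $m\in R(N_1,m_1)\cup R(N_2,m_2)$; (A2) $E,[m_1],[m_2]$ consistent; (A3) for all markings $m_1'$ of $N_1$, $m_2'$ of $N_2$ with $E,[m_1'],[m_2']$ consistent, $m_1'\in R(N_1,m_1)\iff m_2'\in R(N_2,m_2)$.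 TFGs: fix pairwise disjoint sets $K(n)$, $n\in\mathbb{N}$, of constant nodes of value $n$, disjoint from place/variable names; $K=\bigcup_nK(n)$. A TFG with places $P$ is $(V,R,A)$, $V=P\cup S$ with $S\subset K$ finite, $R,A\subseteq V\times V$ disjoint; $v\mathbin{\to\!\bullet} w$ iff $(v,w)\in R$, $v\mathbin{\circ\!\to} w$ iff $(v,w)\in A$, $v\to w$ for either. Roots have no incoming arc; $\circ$-leaves have no outgoing $A$-arc. $v\to^\star w$ means there is a path from $v$ to $w$ or $v=w$. $v\mathbin{\circ\!\to} X$: $X$ is the nonempty set of all $A$-successors of $v$; $X\mathbin{\to\!\bullet} v$: $X$ is the nonempty set of all $R$-predecessors of $v$. Well-formed TFG for $(N_1,m_1)\vartriangleright_E(N_2,m_2)$: (T1) $V\setminus K=P_1\cup P_2\cup\mathrm{fv}(E)$; (T2) nodes in $V\cap K$ are roots; (T3) not both $p\mathbin{\circ\!\to} q$ and $p'\to q$ with $p\ne p'$, and not both $p\mathbin{\to\!\bullet} q$ and $p\mathbin{\circ\!\to} q$; (T4) $v\mathbin{\circ\!\to} X$ or $X\mathbin{\to\!\bullet} v$ iff the equation $v=\sum_{x\in X}x$ is in $E$; (T5) acyclic; (T6) roots not in $K$ are exactly $P_2$, $\circ$-leaves not in $K$ exactly $P_1$. A configuration is a partial $c:V\to\mathbb{N}$ ($\bot$ where undefined) with $c(v)=n$ for $v\in V\cap K(n)$; total if defined everywhere; $c_{|N}$ is its restriction to the places of $N$. $c$ is well-defined if (CBot) whenever $v\to w$, $c(v)=\bot\iff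 c(w)=\bot$; (CEq) whenever $c(v)\ne\bot$ and ($v\mathbin{\circ\!\to} X$ or $X\mathbin{\to\!\bullet} v$), $c(v)=\sum_{x\in X}c(x)$. The concurrency relation $\mathcal{C}$ of $G$ is the relation on nodes with $v\,\mathcal{C}\,w$ iff there is a total, well-defined configuration $c$ with $c_{|N_2}\in R(N_2,m_2)$, $c(v)>0$ and $c(w)>0$. -}

module Defs where

open import Data.Nat using (ℕ; _≤_; _<_; _∸_; _+_)
open import Data.Fin using (Fin)
open import Data.List using (List; []; map)
open import Data.Nat.ListAction using (sum)
open import Data.List.Membership.Propositional using (_∈_; _∉_)
open import Data.List.Relation.Unary.Unique.Propositional using (Unique)
open import Data.List.Relation.Binary.Permutation.Propositional using (_↭_)
open import Data.Product using (Σ; ∃; _×_; _,_)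
open import Data.Sum using (_⊎_)
open import Relation.Binary.PropositionalEquality using (_≡_; _≢_)
open import Relation.Nullary using (¬_)
open import Function.Definitions using (Injective)

infix 3 _⇔'_
_⇔'_ : Set → Set → Set
A ⇔' B = (A → B) × (B → A)

-- Names: place / variable names are  var x  (x : ℕ); the constant
-- nodes of value n are  const n i  (i : ℕ), i.e. K(n) = { const n i }.

data Name : Set where
  var   : ℕ → Name
  const : ℕ → ℕ → Name

record Net : Set where
  field
    np       : ℕ
    nt       : ℕ
    name     : Fin np → ℕ
    name-inj : Injective _≡_ _≡_ name
    Pre      : Fin nt → Fin np → ℕ
    Post     : Fin nt → Fin np → ℕ
open Net public

Marking : Net → Set
Marking N = Fin (np N) → ℕ

Enabled : (N : Net) → Fin (nt N) → Marking N → Set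
Enabled N t m = ∀ p → Pre N t p ≤ m p

fire : (N : Net) → Fin (nt N) → Marking N → Marking N
fire N t m p = m p ∸ Pre N t p + Post N t p

data Reach (N : Net) (m0 : Marking N) : Marking N → Set where
  base : ∀ {m} → (∀ p → m p ≡ m0 p) → Reach N m0 m
  step : ∀ {m m'} (t : Fin (nt N)) → Reach N m0 m → Enabled N t m →
         (∀ p → m' p ≡ fire N t m p) → Reach N m0 m'

Safe : (N : Net) → Marking N → Set
Safe N m0 = ∀ m → Reach N m0 m → ∀ p → m p ≤ 1

IsPlace : Net → ℕ → Set
IsPlace N x = ∃ λ (p : Fin (np N)) → name N p ≡ x

-- Linear systems.  An equation  x = y1 + ... + yl  is a pair (x , ys).
-- Terms may be variables or constants (constant nodes of value n).

Equation : Set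
Equation = Name × List Name

System : Set
System = List Equation

eval : (ℕ → ℕ) → Name → ℕ
eval s (var x)     = s x
eval s (const n _) = n

Sat : System → (ℕ → ℕ) → Set
Sat E s = ∀ {x ys} → (x , ys) ∈ E → eval s x ≡ sum (map (eval s) ys)

Agrees : (N : Net) → Marking N → (ℕ → ℕ) → Set
Agrees N m s = ∀ p → s (name N p) ≡ m p

Consistent1 : System → (N : Net) → Marking N → Set
Consistent1 E N m = ∃ λ s → Sat E s × Agrees N m s

Consistent2 : System → (N1 : Net) → Marking N1 → (N2 : Net) → Marking N2 → Set
Consistent2 E N1 m1 N2 m2 = ∃ λ s → Sat E s × Agrees N1 m1 s × Agrees N2 m2 s

FV : System → ℕ → Set
FV E x = ∃ λ (eq : Equation) → eq ∈ E × (Σ Name λ l → Σ (List Name) λ ys →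
           eq ≡ (l , ys) × (l ≡ var x ⊎ var x ∈ ys))

record EEquiv (E : System) (N1 : Net) (m1 : Marking N1)
              (N2 : Net) (m2 : Marking N2) : Set where
  field
    A1a : ∀ m → Reach N1 m1 m → Consistent1 E N1 m
    A1b : ∀ m → Reach N2 m2 m → Consistent1 E N2 m
    A2  : Consistent2 E N1 m1 N2 m2
    A3  : ∀ (m1' : Marking N1) (m2' : Marking N2) →
          Consistent2 E N1 m1' N2 m2' →
          (Reach N1 m1 m1' ⇔' Reach N2 m2 m2')

record TFG : Set where
  field
    nodes : List Name
    Rarcs : List (Name × Name)
    Aarcs : List (Name × Name)
open TFG public

_⊢_→•_ : TFG → Name → Name → Set
G ⊢ v →• w = (v , w) ∈ Rarcs G

_⊢_∘→_ : TFG → Name → Name → Set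
G ⊢ v ∘→ w = (v , w) ∈ Aarcs G

Arc : TFG → Name → Name → Set
Arc G v w = G ⊢ v →• w ⊎ G ⊢ v ∘→ w

Root : TFG → Name → Set
Root G v = v ∈ nodes G × (∀ u → ¬ Arc G u v)

CircLeaf : TFG → Name → Set
CircLeaf G v = v ∈ nodes G × (∀ w → ¬ (G ⊢ v ∘→ w))

data Star (G : TFG) : Name → Name → Set where
  here : ∀ {v} → Star G v v
  there : ∀ {u v w} → Arc G u v → Star G v w → Star G u w

Plus : TFG → Name → Name → Set
Plus G u w = ∃ λ v → Arc G u v × Star G v w

Enumerates : (Name → Set) → List Name → Set
Enumerates P xs = Unique xs × (∀ x → x ∈ xs ⇔' P x) × xs ≢ []

SuccA : TFG → Name → List Name → Set
SuccA G v xs = Enumerates (λ x → G ⊢ v ∘→ x) xs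

PredR : TFG → Name → List Name → Set
PredR G v xs = Enumerates (λ x → G ⊢ x →• v) xs

record WellFormed (E : System) (N1 : Net) (m1 : Marking N1)
                  (N2 : Net) (m2 : Marking N2) (G : TFG) : Set where
  field
    R⊆V  : ∀ {v w} → G ⊢ v →• w → v ∈ nodes G × w ∈ nodes G
    A⊆V  : ∀ {v w} → G ⊢ v ∘→ w → v ∈ nodes G × w ∈ nodes G
    R∩A  : ∀ {v w} → G ⊢ v →• w → ¬ (G ⊢ v ∘→ w)
    T1   : ∀ x → (var x ∈ nodes G ⇔' (IsPlace N1 x ⊎ IsPlace N2 x ⊎ FV E x))
    T2   : ∀ n i → const n i ∈ nodes G → Root G (const n i)
    T3a  : ∀ {p p' q} → G ⊢ p ∘→ q → Arc G p' q → p ≡ p'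
    T3b  : ∀ {p q} → G ⊢ p →• q → ¬ (G ⊢ p ∘→ q)
    T4a  : ∀ v xs → (SuccA G v xs ⊎ PredR G v xs) →
           ∃ λ ys → (v , ys) ∈ E × ys ↭ xs
    T4b  : ∀ v ys → (v , ys) ∈ E → (SuccA G v ys ⊎ PredR G v ys)
    T5   : ∀ v → ¬ Plus G v v
    T6a  : ∀ x → (Root G (var x) ⇔' IsPlace N2 x)
    T6b  : ∀ x → (CircLeaf G (var x) ⇔' IsPlace N1 x)

-- Total configurations (a configuration defined on all of V is given
-- as a function Name → ℕ; its values outside V are irrelevant).

TotalConfig : TFG → (Name → ℕ) → Set
TotalConfig G c = ∀ n i → const n i ∈ nodes G → c (const n i) ≡ n

-- well-definedness of a total configuration: (CBot) holds trivially,
-- (CEq):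
WellDefined : TFG → (Name → ℕ) → Set
WellDefined G c = ∀ v xs → v ∈ nodes G → (SuccA G v xs ⊎ PredR G v xs) →
                  c v ≡ sum (map c xs)

restrict : (N : Net) → (Name → ℕ) → Marking N
restrict N c p = c (var (name N p))

Conc : TFG → (N2 : Net) → Marking N2 → Name → Name → Set
Conc G N2 m2 v w = v ∈ nodes G × w ∈ nodes G ×
  (∃ λ (c : Name → ℕ) → TotalConfig G c × WellDefined G c ×
     Reach N2 m2 (restrict N2 c) × 0 < c v × 0 < c w)

{-# OPTIONS --safe #-}
-- A positive value in a well-defined configuration can always be traced one arc
-- upwards: across an A-arc u ∘→ w because c u is a sum containing c w, across an
-- R-arc u →• w because c w is a sum of the values of the R-predecessors of w, one
-- of which must be positive.  Since the graph is finite and acyclic, this backward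
-- walk from v reaches a root v0 with c v0 > 0, and the configuration witnessing
-- v 𝒞 v also witnesses v0 𝒞 v0.
module Submission where

open import Defs
open import Data.List.Membership.Propositional using (_∈_)
open import Data.Product using (∃; _×_)

open import Data.Nat as ℕ using (ℕ; zero; suc; _≤_; _<_; z≤n; s≤s)
open import Data.Nat.Properties using (m≤m+n; m≤n+m; ≤-trans; ≤-reflexive; <-≤-trans)
open import Data.Nat.Induction using (<-wellFounded)
open import Data.Nat.ListAction using (sum)
open import Data.List using (List; []; _∷_; _++_; map; filter; length; deduplicate)
open import Data.List.Properties using (filter-notAll)
open import Data.List.Relation.Unary.Any using (here; there)
open import Data.List.Membership.Propositional using (lose)
open import Data.List.Membership.Propositional.Properties
  using (∈-map⁺; ∈-map⁻; ∈-filter⁺; ∈-filter⁻; ∈-++⁺ˡ; ∈-++⁺ʳ; ∈-++⁻;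
         ∈-deduplicate⁺; ∈-deduplicate⁻)
open import Data.List.Relation.Unary.Unique.DecPropositional.Properties using (deduplicate-!)
open import Data.Product using (_,_; proj₁; proj₂; uncurry)
open import Data.Sum using (inj₁; inj₂; [_,_])
open import Function using (_∘_)
open import Induction.WellFounded using (Acc; acc)
open import Relation.Binary.Definitions using (DecidableEquality)
open import Relation.Binary.PropositionalEquality using (_≡_; _≢_; refl; sym; cong; cong₂; subst)
open import Relation.Nullary using (¬_; Dec; yes; no; ¬?)
open import Relation.Nullary.Decidable using (map′; _×-dec_)

infix 4 _≟_

_≟_ : DecidableEquality Name
var x     ≟ var y     = map′ (cong var) (λ { refl → refl }) (x ℕ.≟ y)
const n i ≟ const m j =
  map′ (uncurry (cong₂ const)) (λ { refl → refl , refl }) (n ℕ.≟ m ×-dec i ℕ.≟ j)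
var _     ≟ const _ _ = no λ ()
const _ _ ≟ var _     = no λ ()

∈⇒≤sum : ∀ {n ns} → n ∈ ns → n ≤ sum ns
∈⇒≤sum (here refl)  = m≤m+n _ _
∈⇒≤sum (there n∈ns) = ≤-trans (∈⇒≤sum n∈ns) (m≤n+m _ _)

0<sum⇒∃0< : ∀ ns → 0 < sum ns → ∃ λ n → n ∈ ns × 0 < n
0<sum⇒∃0< (zero  ∷ ns) 0<Σ = let n , n∈ns , 0<n = 0<sum⇒∃0< ns 0<Σ in n , there n∈ns , 0<n
0<sum⇒∃0< (suc n ∷ ns) _   = suc n , here refl , s≤s z≤n

module _ {P : Name → Set} where

  enumerates-deduplicate : ∀ {x} xs → (∀ y → y ∈ xs ⇔' P y) → P x →
                           Enumerates P (deduplicate _≟_ xs)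
  enumerates-deduplicate xs xs⇔P Px =
    deduplicate-! _≟_ xs ,
    (λ y → proj₁ (xs⇔P y) ∘ ∈-deduplicate⁻ _≟_ xs , ∈-deduplicate⁺ _≟_ ∘ proj₂ (xs⇔P y)) ,
    nonempty (∈-deduplicate⁺ _≟_ (proj₂ (xs⇔P _) Px))
    where
    nonempty : ∀ {y ys} → y ∈ ys → ys ≢ []
    nonempty (here _)  ()
    nonempty (there _) ()

targets : Name → List (Name × Name) → List Name
targets u L = map proj₂ (filter (λ e → proj₁ e ≟ u) L)

sources : Name → List (Name × Name) → List Name
sources w L = map proj₁ (filter (λ e → proj₂ e ≟ w) L)

∈-targets : ∀ u L x → x ∈ targets u L ⇔' (u , x) ∈ L
∈-targets u L x = sound , λ e∈L → ∈-map⁺ proj₂ (∈-filter⁺ _ e∈L refl)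
  where
  sound : x ∈ targets u L → (u , x) ∈ L
  sound x∈ with ∈-map⁻ proj₂ x∈
  ... | (_ , _) , e∈ , refl with ∈-filter⁻ (λ e → proj₁ e ≟ u) e∈
  ... | e∈L , refl = e∈L

∈-sources : ∀ w L x → x ∈ sources w L ⇔' (x , w) ∈ L
∈-sources w L x = sound , λ e∈L → ∈-map⁺ proj₁ (∈-filter⁺ _ e∈L refl)
  where
  sound : x ∈ sources w L → (x , w) ∈ L
  sound x∈ with ∈-map⁻ proj₁ x∈
  ... | (_ , _) , e∈ , refl with ∈-filter⁻ (λ e → proj₂ e ≟ w) e∈
  ... | e∈L , refl = e∈L

A-successors : TFG → Name → List Name
A-successors G u = deduplicate _≟_ (targets u (Aarcs G))

R-predecessors : TFG → Name → List Name
R-predecessors G w = deduplicate _≟_ (sources w (Rarcs G))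

succA-A-successors : ∀ {G u w} → G ⊢ u ∘→ w → SuccA G u (A-successors G u)
succA-A-successors {G} {u} = enumerates-deduplicate _ (∈-targets u (Aarcs G))

predR-R-predecessors : ∀ {G u w} → G ⊢ u →• w → PredR G w (R-predecessors G w)
predR-R-predecessors {G} {w = w} = enumerates-deduplicate _ (∈-sources w (Rarcs G))

arcs : TFG → List (Name × Name)
arcs G = Rarcs G ++ Aarcs G

has-predecessor? : ∀ G w → Dec (∃ λ u → Arc G u w)
has-predecessor? G w = map′ sound complete (nonempty? (sources w (arcs G)))
  where
  nonempty? : (xs : List Name) → Dec (∃ λ x → x ∈ xs)
  nonempty? []      = no λ ()
  nonempty? (x ∷ _) = yes (x , here refl)
  sound : (∃ λ u → u ∈ sources w (arcs G)) → ∃ λ u → Arc G u w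
  sound (u , u∈) = u , ∈-++⁻ (Rarcs G) (proj₁ (∈-sources w (arcs G) u) u∈)
  complete : (∃ λ u → Arc G u w) → ∃ λ u → u ∈ sources w (arcs G)
  complete (u , u→w) =
    u , proj₂ (∈-sources w (arcs G) u) ([ ∈-++⁺ˡ , ∈-++⁺ʳ (Rarcs G) ] u→w)

star-snoc : ∀ {G u v w} → Star G u v → Arc G v w → Star G u w
star-snoc here          v→w = there v→w here
star-snoc (there u→ s) v→w = there u→ (star-snoc s v→w)

module _ {G : TFG} (source∈V : ∀ {u w} → Arc G u w → u ∈ nodes G)
         (acyclic : ∀ v → ¬ Plus G v v) where

  root-ancestor : (P : Name → Set) →
                  (∀ {u w} → Arc G u w → P w → ∃ λ u' → Arc G u' w × P u') →
                  ∀ {w} → w ∈ nodes G → P w → ∃ λ v0 → Root G v0 × P v0 × Star G v0 w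
  root-ancestor P upward w∈V Pw =
    walk (nodes G) (<-wellFounded _) (λ (_ , u→ , _) → source∈V u→) w∈V Pw
    where
    -- ws over-approximates the ancestors still to visit; acyclicity lets each step drop one.
    walk : ∀ ws → Acc _<_ (length ws) → ∀ {w} → (∀ {a} → Plus G a w → a ∈ ws) →
           w ∈ nodes G → P w → ∃ λ v0 → Root G v0 × P v0 × Star G v0 w
    walk ws (acc smaller) {w} ancestors⊆ws w∈V Pw with has-predecessor? G w
    ... | no none = w , (w∈V , λ u u→w → none (u , u→w)) , Pw , here
    ... | yes (_ , u→w) with upward u→w Pw
    ... | u , u→w' , Pu =
      let v0 , root , Pv0 , v0→⋆u =
            walk (filter (λ a → ¬? (a ≟ u)) ws) (smaller shrinks) ancestors⊆ws'
                 (source∈V u→w') Pu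
      in v0 , root , Pv0 , star-snoc v0→⋆u u→w'
      where
      shrinks : length (filter (λ a → ¬? (a ≟ u)) ws) < length ws
      shrinks = filter-notAll _ ws (lose (ancestors⊆ws (_ , u→w' , here)) λ u≢u → u≢u refl)
      ancestors⊆ws' : ∀ {a} → Plus G a u → a ∈ filter (λ a → ¬? (a ≟ u)) ws
      ancestors⊆ws' {a} a→⁺u@(b , a→b , b→⋆u) =
        ∈-filter⁺ _ (ancestors⊆ws (b , a→b , star-snoc b→⋆u u→w'))
                    λ { refl → acyclic a a→⁺u }

module _ {G : TFG} {c : Name → ℕ}
         (R⊆V : ∀ {v w} → G ⊢ v →• w → v ∈ nodes G × w ∈ nodes G)
         (A⊆V : ∀ {v w} → G ⊢ v ∘→ w → v ∈ nodes G × w ∈ nodes G)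
         (wd : WellDefined G c) where

  positive-predecessor : ∀ {u w} → Arc G u w → 0 < c w → ∃ λ u' → Arc G u' w × 0 < c u'
  positive-predecessor {u} {w} (inj₂ u∘→w) 0<cw = u , inj₂ u∘→w , <-≤-trans 0<cw cw≤cu
    where
    succ-u : SuccA G u (A-successors G u)
    succ-u = succA-A-successors {G} u∘→w
    w∈succ-u : w ∈ A-successors G u
    w∈succ-u = proj₂ (proj₁ (proj₂ succ-u) w) u∘→w
    cw≤cu : c w ≤ c u
    cw≤cu = ≤-trans (∈⇒≤sum (∈-map⁺ c w∈succ-u))
                    (≤-reflexive (sym (wd u _ (proj₁ (A⊆V u∘→w)) (inj₁ succ-u))))
  positive-predecessor {u} {w} (inj₁ u→•w) 0<cw
    with 0<sum⇒∃0< _ (subst (0 <_) (wd w _ (proj₂ (R⊆V u→•w)) (inj₂ pred-w)) 0<cw)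
    where
    pred-w : PredR G w (R-predecessors G w)
    pred-w = predR-R-predecessors {G} u→•w
  ... | _ , n∈ , 0<n with ∈-map⁻ c n∈
  ... | u' , u'∈ , refl =
    u' , inj₁ (proj₁ (proj₁ (proj₂ (predR-R-predecessors {G} u→•w)) u') u'∈) , 0<n

lemma6 : ∀ (E : System) (N1 N2 : Net) (m1 : Marking N1) (m2 : Marking N2) (G : TFG) →
    EEquiv E N1 m1 N2 m2 → Safe N1 m1 → Safe N2 m2 → WellFormed E N1 m1 N2 m2 G →
    ∀ v → v ∈ nodes G → Conc G N2 m2 v v →
    ∃ λ v0 → Root G v0 × Conc G N2 m2 v0 v0 × Star G v0 v
lemma6 E N1 N2 m1 m2 G _ _ _ WF v v∈V (_ , _ , c , total , wd , reach , 0<cv , _) =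
  let v0 , root , 0<cv0 , v0→⋆v =
        root-ancestor source∈V T5 (λ u → 0 < c u) (positive-predecessor R⊆V A⊆V wd) v∈V 0<cv
  in v0 , root , (proj₁ root , proj₁ root , c , total , wd , reach , 0<cv0 , 0<cv0) , v0→⋆v
  where
  open WellFormed WF
  source∈V : ∀ {u w} → Arc G u w → u ∈ nodes G
  source∈V = [ proj₁ ∘ R⊆V , proj₁ ∘ A⊆V ]
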